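{- Let $(P,\le)$ be a finite poset which is an upper semi-lattice. A directed graph $G$ is isomorphic to a graph $G_\alpha$, where $\alpha$ is a main skeleton over $P$, if and only if $|V(G)|=|P|$ and there exists a faithful correspondence between $\mathcal O(G)$ and $\mathrm{Up}[R]$ for some $R\subseteq P$.
   Context: For a directed graph $G=(V,E)$, $\mathrm{out}_G(v)=\{w\mid (v,w)\in E\}$ and $\mathcal O(G)=\{\mathrm{out}_G(v)\mid v\in V\}$. An upper semi-lattice is a poset in which every subset has a least upper bound. For $x\in P$, $\mathrm{Up}(x)=\{y\in P\mid x\le y\}$, and for $R\subseteq P$, $\mathrm{Up}[R]=\{\mathrm{Up}(x)\mid x\in R\}$. For a function $f:P\to P$ with image $R=f(P)$, the main skeleton of $f$ is $\alpha=(\mathrm{Up}[R],R,f)$, where the cone $\mathrm{Up}(z)$ is indexed by $z\in R$; the graph it defines is $G_\alpha$ with vertex set $P$ and edge set $\{(x,y)\mid x,y\in P,\ f(x)\le y\}$. A main skeleton over $P$ is the main skeleton of some function $f:P\to P$. For a family $\mathcal O$, $\mathcal O^\cap$ is the smallest family containing $\mathcal O$ closed under intersection of two sets; a faithful correspondence between $\mathcal O_1$ and $\mathcal O_2$ is a bijection $\eta:\mathcal O_1^\cap\to\mathcal O_2^\cap$ with $|X|=|\eta(X)|$ and $\eta(X\cap Y)=\eta(X)\cap\eta(Y)$ for all $X,Y\in\mathcal O_1^\cap$. -}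

module Defs where

open import Level using (Level)
open import Data.Nat using (ℕ)
open import Data.Bool using (Bool)
open import Data.Fin using (Fin)
open import Data.Fin.Subset using (Subset; _∈_; _∩_; ∣_∣)
open import Data.Vec using (tabulate)
open import Data.Product using (Σ; ∃; _×_; _,_)
open import Relation.Binary.Core using (Rel)
open import Relation.Binary.Structures using (IsDecPartialOrder)
open import Relation.Binary.PropositionalEquality using (_≡_)
open import Relation.Nullary.Decidable using (⌊_⌋)

Graph : ℕ → Set
Graph m = Fin m → Fin m → Bool

out : ∀ {m} → Graph m → Fin m → Subset m
out E v = tabulate (E v)

Family : ℕ → Set₁
Family k = Subset k → Set

𝒪 : ∀ {m} → Graph m → Family m
𝒪 E X = ∃ λ v → out E v ≡ X

data _^∩ {k : ℕ} (F : Family k) : Family k where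
  base  : ∀ {X} → F X → (F ^∩) X
  inter : ∀ {X Y} → (F ^∩) X → (F ^∩) Y → (F ^∩) (X ∩ Y)

-- Faithful correspondence between 𝒪₁ and 𝒪₂: a bijection η : 𝒪₁^∩ → 𝒪₂^∩
-- (given as a function on subsets, only its restriction to 𝒪₁^∩ matters)
-- preserving cardinality and binary intersections.
record FaithfulCorrespondence {k l : ℕ} (𝒪₁ : Family k) (𝒪₂ : Family l) : Set where
  field
    η         : Subset k → Subset l
    maps-into : ∀ X → (𝒪₁ ^∩) X → (𝒪₂ ^∩) (η X)
    injective : ∀ X Y → (𝒪₁ ^∩) X → (𝒪₁ ^∩) Y → η X ≡ η Y → X ≡ Y
    surjective : ∀ Z → (𝒪₂ ^∩) Z → ∃ λ X → (𝒪₁ ^∩) X × η X ≡ Z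
    card      : ∀ X → (𝒪₁ ^∩) X → ∣ X ∣ ≡ ∣ η X ∣
    inter-hom : ∀ X Y → (𝒪₁ ^∩) X → (𝒪₁ ^∩) Y → η (X ∩ Y) ≡ η X ∩ η Y

record GraphIso {m n : ℕ} (G : Graph m) (H : Graph n) : Set where
  field
    to      : Fin m → Fin n
    from    : Fin n → Fin m
    from∘to : ∀ v → from (to v) ≡ v
    to∘from : ∀ w → to (from w) ≡ w
    edges   : ∀ u v → G u v ≡ H (to u) (to v)

module _ {n : ℕ} {ℓ : Level} {_≤_ : Rel (Fin n) ℓ}
         (isDPO : IsDecPartialOrder _≡_ _≤_) where
  open IsDecPartialOrder isDPO using (_≤?_)

  IsUpperSemiLattice : Set ℓ
  IsUpperSemiLattice = ∀ (S : Subset n) → ∃ λ u →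
    (∀ x → x ∈ S → x ≤ u) × (∀ v → (∀ x → x ∈ S → x ≤ v) → u ≤ v)

  Up : Fin n → Subset n
  Up x = tabulate (λ y → ⌊ x ≤? y ⌋)

  Up[_] : Subset n → Family n
  Up[ R ] X = ∃ λ x → x ∈ R × Up x ≡ X

  -- G_α for the main skeleton α of f : P → P: edges (x,y) with f(x) ≤ y
  G[_] : (Fin n → Fin n) → Graph n
  G[ f ] x y = ⌊ f x ≤? y ⌋

-- (⇒) An isomorphism σ : G ≅ G_f carries out_G(v) to Up(f(σ v)).  Relabelling subsets
--     along σ preserves intersections and sizes, so it is a faithful correspondence between
--     𝒪(G) and Up[image f].
-- (⇐) Let η be the correspondence.  In a semi-lattice Up x ∩ Up y = Up (x ∨ y), so every
--     η(out v) is an up-set Up(g v).  View out_G and η ∘ out_G as two 0/1 matrices.  For a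
--     set S of rows, the number of columns containing S is the size of the intersection of
--     the rows in S, and η preserves these sizes.  A combinatorial matching lemma (two
--     families of sets with equal superset counts are reindexings of each other) then gives
--     a permutation π of the columns, which is an isomorphism G ≅ G_f for f = g ∘ π⁻¹.
module Submission where

open import Defs
open import Level using (Level)
open import Data.Nat using (ℕ; zero; suc; _+_; _≤_; _<_; z≤n; s≤s)
open import Data.Nat.Properties
  using (≤-refl; ≤-trans; ≤-total; ≤-pred; <⇒≱; m≤n+m; +-cancelˡ-≡; +-0-commutativeMonoid)
open import Data.Bool using (true; false; _∧_; if_then_else_)
open import Data.Bool.Properties using (T-≡)
open import Data.Fin using (Fin; zero; suc; punchIn; punchOut)
open import Data.Fin.Properties using (any?; punchIn-punchOut) renaming (_≟_ to _≟ᶠ_)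
open import Data.Fin.Subset using (Subset; inside; outside; ⊤; _∩_; _∪_; ⁅_⁆; ∣_∣; _∈_; _⊆_)
open import Data.Fin.Subset.Properties
  using (_⊆?_; ⊆-antisym; drop-∷-⊆; p⊆q⇒∣p∣≤∣q∣; ∣⊤∣≡n; ∩-identityʳ;
         x∈p∩q⁺; x∈p∩q⁻; x∈⁅x⁆; x∈⁅y⁆⇒x≡y; x∈p∪q⁺; x∈p∪q⁻)
open import Data.Fin.Permutation as Perm
  using (Permutation; _⟨$⟩ʳ_; _⟨$⟩ˡ_; insert)
open import Data.Vec using ([]; _∷_; here; tabulate; lookup)
open import Data.Vec.Properties
  using (lookup∘tabulate; tabulate∘lookup; tabulate-cong; lookup-zipWith; lookup-replicate;
         []=⇒lookup; lookup⇒[]=)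
open import Data.Product using (Σ; ∃; _×_; _,_; proj₁; proj₂)
open import Data.Sum using (_⊎_; inj₁; inj₂)
open import Function using (_∘_; id; _⇔_; mk⇔; Equivalence)
open import Relation.Nullary using (Dec; yes; no; does; contradiction)
open import Relation.Nullary.Decidable using (⌊_⌋; toWitness; fromWitness; T?)
open import Relation.Unary using (Pred; Decidable)
open import Relation.Binary.Core using (Rel)
open import Relation.Binary.Structures using (IsDecPartialOrder)
open import Relation.Binary.PropositionalEquality
open import Algebra.Properties.CommutativeMonoid.Sum +-0-commutativeMonoid
  using (sum; sum-remove; sum-permute; sum-cong-≗)

open ≡-Reasoning

indicator : ∀ {a} {A : Set a} → Dec A → ℕ
indicator a? = if does a? then 1 else 0

count : ∀ {p ℓ} {P : Pred (Fin p) ℓ} → Decidable P → ℕ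
count P? = sum (λ i → indicator (P? i))

count-≗ : ∀ {p ℓ₁ ℓ₂} {P : Pred (Fin p) ℓ₁} {Q : Pred (Fin p) ℓ₂}
          (P? : Decidable P) (Q? : Decidable Q) →
          (∀ i → does (P? i) ≡ does (Q? i)) → count P? ≡ count Q?
count-≗ P? Q? same = sum-cong-≗ (λ i → cong (λ b → if b then 1 else 0) (same i))

count-remove : ∀ {p ℓ} {P : Pred (Fin (suc p)) ℓ} (P? : Decidable P) i →
               count P? ≡ indicator (P? i) + count (P? ∘ punchIn i)
count-remove P? i = sum-remove {i = i} (λ j → indicator (P? j))

count-permute : ∀ {m n ℓ} {P : Pred (Fin n) ℓ} (P? : Decidable P) (π : Permutation m n) →
                count P? ≡ count (P? ∘ (π ⟨$⟩ʳ_))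
count-permute P? π = sum-permute (λ i → indicator (P? i)) π

count-pos : ∀ {p ℓ} {P : Pred (Fin p) ℓ} (P? : Decidable P) i → P i → 0 < count P?
count-pos P? zero Pi with P? zero
... | yes _  = s≤s z≤n
... | no ¬Pi = contradiction Pi ¬Pi
count-pos P? (suc i) Pi = ≤-trans (count-pos (P? ∘ suc) i Pi) (m≤n+m _ _)

count-witness : ∀ {p ℓ} {P : Pred (Fin p) ℓ} (P? : Decidable P) → 0 < count P? → ∃ P
count-witness {zero} P? ()
count-witness {suc p} P? pos with P? zero
... | yes P0 = zero , P0
... | no _ with count-witness (P? ∘ suc) pos
...   | i , Pi = suc i , Pi

∣∣≡count : ∀ {n} (X : Subset n) → ∣ X ∣ ≡ count (T? ∘ lookup X)
∣∣≡count []            = refl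
∣∣≡count (inside ∷ X)  = cong suc (∣∣≡count X)
∣∣≡count (outside ∷ X) = ∣∣≡count X

≗⇒≡ : ∀ {n} {X Y : Subset n} → (∀ i → lookup X i ≡ lookup Y i) → X ≡ Y
≗⇒≡ {X = X} {Y} same = trans (sym (tabulate∘lookup X)) (trans (tabulate-cong same) (tabulate∘lookup Y))

∈-decided : ∀ {n ℓ} {P : Pred (Fin n) ℓ} (P? : Decidable P) x →
            x ∈ tabulate (λ y → ⌊ P? y ⌋) ⇔ P x
∈-decided P? x = mk⇔
  (λ x∈ → toWitness {a? = P? x} (Equivalence.from T-≡ (trans (sym (lookup∘tabulate _ x)) ([]=⇒lookup x∈))))
  (λ Px → lookup⇒[]= x _ (trans (lookup∘tabulate _ x) (Equivalence.to T-≡ (fromWitness Px))))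

⊆-card-≡ : ∀ {k} {X Y : Subset k} → X ⊆ Y → ∣ Y ∣ ≤ ∣ X ∣ → X ≡ Y
⊆-card-≡ {X = []}          {[]}          _   _  = refl
⊆-card-≡ {X = outside ∷ X} {outside ∷ Y} X⊆Y le = cong (outside ∷_) (⊆-card-≡ (drop-∷-⊆ X⊆Y) le)
⊆-card-≡ {X = outside ∷ X} {inside ∷ Y}  X⊆Y le =
  contradiction le (<⇒≱ (s≤s (p⊆q⇒∣p∣≤∣q∣ (drop-∷-⊆ X⊆Y))))
⊆-card-≡ {X = inside ∷ X}  {outside ∷ Y} X⊆Y _  = contradiction (X⊆Y here) λ ()
⊆-card-≡ {X = inside ∷ X}  {inside ∷ Y}  X⊆Y le = cong (inside ∷_) (⊆-card-≡ (drop-∷-⊆ X⊆Y) (≤-pred le))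

-- Matching lemma: families of subsets with equal superset counts are reindexings of
-- each other

supersets : ∀ {p k} → (Fin p → Subset k) → Subset k → ℕ
supersets a S = count (λ i → S ⊆? a i)

SameSupersets : ∀ {p q k} → (Fin p → Subset k) → (Fin q → Subset k) → Set
SameSupersets a b = ∀ S → supersets a S ≡ supersets b S

-- Every member of a is contained in some member of b (a i is a superset of itself).
covered : ∀ {p q k} {a : Fin p → Subset k} {b : Fin q → Subset k} →
          SameSupersets a b → ∀ i → ∃ λ j → a i ⊆ b j
covered {a = a} {b} same i =
  count-witness (λ j → a i ⊆? b j) (subst (0 <_) (same (a i)) (count-pos (λ l → a i ⊆? a l) i id))

-- A largest member a i of a also occurs in b: a i ⊆ b j ⊆ a l and ∣ a l ∣ ≤ ∣ a i ∣.
largest-shared : ∀ {p q k} {a : Fin p → Subset k} {b : Fin q → Subset k} →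
                 SameSupersets a b → ∀ i → (∀ l → ∣ a l ∣ ≤ ∣ a i ∣) → ∃ λ j → b j ≡ a i
largest-shared {a = a} {b} same i largest with covered {a = a} {b} same i
... | j , ai⊆bj with covered {a = b} {a} (sym ∘ same) j
...   | l , bj⊆al = j , sym (⊆-card-≡ ai⊆bj (≤-trans (p⊆q⇒∣p∣≤∣q∣ bj⊆al) (largest l)))

remove-shared : ∀ {p q k} {a : Fin (suc p) → Subset k} {b : Fin (suc q) → Subset k} {i j} →
                SameSupersets a b → b j ≡ a i → SameSupersets (a ∘ punchIn i) (b ∘ punchIn j)
remove-shared {a = a} {b} {i} {j} same bj≡ai S = +-cancelˡ-≡ (indicator (S ⊆? a i)) _ _ (begin
  indicator (S ⊆? a i) + supersets (a ∘ punchIn i) S  ≡⟨ count-remove (λ x → S ⊆? a x) i ⟨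
  supersets a S                                       ≡⟨ same S ⟩
  supersets b S                                       ≡⟨ count-remove (λ x → S ⊆? b x) j ⟩
  indicator (S ⊆? b j) + supersets (b ∘ punchIn j) S  ≡⟨ cong (λ X → indicator (S ⊆? X) + _) bj≡ai ⟩
  indicator (S ⊆? a i) + supersets (b ∘ punchIn j) S  ∎)

maximiser : ∀ {p} (c : Fin (suc p) → ℕ) → ∃ λ i → ∀ j → c j ≤ c i
maximiser {zero} c = zero , λ { zero → ≤-refl }
maximiser {suc p} c with maximiser (c ∘ suc)
... | i , max with ≤-total (c zero) (c (suc i))
...   | inj₁ c0≤ = suc i , λ { zero → c0≤ ; (suc j) → max j }
...   | inj₂ ≤c0 = zero  , λ { zero → ≤-refl ; (suc j) → ≤-trans (max j) ≤c0 }

-- A reindexing of the remaining members extends to all members by sending i to j.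
-- (insert i j ρ is defined by the same case split on i ≟ k, so both branches compute.)
insert-matches : ∀ {a} {A : Set a} {p q} {x : Fin (suc p) → A} {y : Fin (suc q) → A} i j
                 (ρ : Permutation p q) → y j ≡ x i →
                 (∀ k → y (punchIn j (ρ ⟨$⟩ʳ k)) ≡ x (punchIn i k)) → ∀ k → y (insert i j ρ ⟨$⟩ʳ k) ≡ x k
insert-matches {x = x} {y} i j ρ yj≡xi matches k with i ≟ᶠ k
... | yes refl = yj≡xi
... | no i≢k   = trans (matches (punchOut i≢k)) (cong x (punchIn-punchOut i≢k))

-- Induction on the size: match a largest member of a with its copy in b and recurse.
matching : ∀ {k} p q (a : Fin p → Subset k) (b : Fin q → Subset k) → SameSupersets a b →
           Σ (Permutation p q) λ π → ∀ i → b (π ⟨$⟩ʳ i) ≡ a i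
matching zero    zero    a b same = Perm.id , λ ()
matching zero    (suc q) a b same with covered {a = b} {a} (sym ∘ same) zero
... | () , _
matching (suc p) zero    a b same with covered {a = a} {b} same zero
... | () , _
matching (suc p) (suc q) a b same with maximiser (∣_∣ ∘ a)
... | i , largest with largest-shared {a = a} {b} same i largest
...   | j , bj≡ai with matching p q (a ∘ punchIn i) (b ∘ punchIn j) (remove-shared {a = a} {b} same bj≡ai)
...     | ρ , matches = insert i j ρ , insert-matches {x = a} {y = b} i j ρ bj≡ai matches

⋂[_]_ : ∀ {p k} → Subset p → (Fin p → Subset k) → Subset k
⋂[ [] ]          h = ⊤
⋂[ inside ∷ S ]  h = h zero ∩ ⋂[ S ] (h ∘ suc)
⋂[ outside ∷ S ] h = ⋂[ S ] (h ∘ suc)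

column : ∀ {p k} → (Fin p → Subset k) → Fin k → Subset p
column h w = tabulate (λ v → lookup (h v) w)

does-⊆?-inside : ∀ {k} x (S T : Subset k) → x ∧ does (S ⊆? T) ≡ does (inside ∷ S ⊆? x ∷ T)
does-⊆?-inside true  S T = refl
does-⊆?-inside false S T = refl

lookup-⋂ : ∀ {p k} (S : Subset p) (h : Fin p → Subset k) w →
           lookup (⋂[ S ] h) w ≡ does (S ⊆? column h w)
lookup-⋂ []            h w = lookup-replicate w true
lookup-⋂ (outside ∷ S) h w = lookup-⋂ S (h ∘ suc) w
lookup-⋂ (inside ∷ S)  h w = begin
  lookup (h zero ∩ ⋂[ S ] (h ∘ suc)) w              ≡⟨ lookup-zipWith _∧_ w (h zero) _ ⟩
  lookup (h zero) w ∧ lookup (⋂[ S ] (h ∘ suc)) w   ≡⟨ cong (lookup (h zero) w ∧_) (lookup-⋂ S (h ∘ suc) w) ⟩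
  lookup (h zero) w ∧ does (S ⊆? column (h ∘ suc) w) ≡⟨ does-⊆?-inside (lookup (h zero) w) S _ ⟩
  does (inside ∷ S ⊆? column h w)                   ∎

supersets-column : ∀ {p k} (h : Fin p → Subset k) S → supersets (column h) S ≡ ∣ ⋂[ S ] h ∣
supersets-column h S =
  sym (trans (∣∣≡count (⋂[ S ] h)) (count-≗ (T? ∘ lookup (⋂[ S ] h)) (λ w → S ⊆? column h w) (lookup-⋂ S h)))

columns-reindexed : ∀ {p k l} (h₁ : Fin p → Subset k) (h₂ : Fin p → Subset l) (ρ : Fin k → Fin l) →
                    (∀ w → column h₂ (ρ w) ≡ column h₁ w) → ∀ v w → lookup (h₁ v) w ≡ lookup (h₂ v) (ρ w)
columns-reindexed h₁ h₂ ρ same v w = begin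
  lookup (h₁ v) w             ≡⟨ lookup∘tabulate (λ u → lookup (h₁ u) w) v ⟨
  lookup (column h₁ w) v      ≡⟨ cong (λ X → lookup X v) (same w) ⟨
  lookup (column h₂ (ρ w)) v  ≡⟨ lookup∘tabulate (λ u → lookup (h₂ u) (ρ w)) v ⟩
  lookup (h₂ v) (ρ w)         ∎

module _ {k l} {F₁ : Family k} {F₂ : Family l} (φ : FaithfulCorrespondence F₁ F₂) where
  open FaithfulCorrespondence φ

  η-⋂ : ∀ {p} (h : Fin p → Subset k) → (∀ v → (F₁ ^∩) (h v)) → ∀ S →
        (⋂[ S ] h ≡ ⊤ × ⋂[ S ] (η ∘ h) ≡ ⊤) ⊎ ((F₁ ^∩) (⋂[ S ] h) × η (⋂[ S ] h) ≡ ⋂[ S ] (η ∘ h))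
  η-⋂ h h∈ []            = inj₁ (refl , refl)
  η-⋂ h h∈ (outside ∷ S) = η-⋂ (h ∘ suc) (h∈ ∘ suc) S
  η-⋂ h h∈ (inside ∷ S)  with η-⋂ (h ∘ suc) (h∈ ∘ suc) S
  ... | inj₁ (⋂≡⊤ , η⋂≡⊤) rewrite ⋂≡⊤ | η⋂≡⊤ | ∩-identityʳ (h zero) | ∩-identityʳ (η (h zero)) =
    inj₂ (h∈ zero , refl)
  ... | inj₂ (⋂∈ , η⋂) =
    inj₂ (inter (h∈ zero) ⋂∈ , trans (inter-hom _ _ (h∈ zero) ⋂∈) (cong (η (h zero) ∩_) η⋂))

  ∣η-⋂∣ : k ≡ l → ∀ {p} (h : Fin p → Subset k) → (∀ v → (F₁ ^∩) (h v)) → ∀ S →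
          ∣ ⋂[ S ] h ∣ ≡ ∣ ⋂[ S ] (η ∘ h) ∣
  ∣η-⋂∣ k≡l h h∈ S with η-⋂ h h∈ S
  ... | inj₂ (⋂∈ , η⋂)     = trans (card _ ⋂∈) (cong ∣_∣ η⋂)
  ... | inj₁ (⋂≡⊤ , η⋂≡⊤) = begin
    ∣ ⋂[ S ] h ∣        ≡⟨ cong ∣_∣ ⋂≡⊤ ⟩
    ∣ ⊤ {k} ∣           ≡⟨ ∣⊤∣≡n k ⟩
    k                   ≡⟨ k≡l ⟩
    l                   ≡⟨ ∣⊤∣≡n l ⟨
    ∣ ⊤ {l} ∣           ≡⟨ cong ∣_∣ η⋂≡⊤ ⟨
    ∣ ⋂[ S ] (η ∘ h) ∣  ∎

relabel : ∀ {m n} → Permutation m n → Subset m → Subset n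
relabel σ X = tabulate (λ y → lookup X (σ ⟨$⟩ˡ y))

module _ {m n} (σ : Permutation m n) where

  lookup-relabel : ∀ X x → lookup (relabel σ X) (σ ⟨$⟩ʳ x) ≡ lookup X x
  lookup-relabel X x = trans (lookup∘tabulate _ (σ ⟨$⟩ʳ x)) (cong (lookup X) (Perm.inverseˡ σ))

  relabel-∩ : ∀ X Y → relabel σ (X ∩ Y) ≡ relabel σ X ∩ relabel σ Y
  relabel-∩ X Y = ≗⇒≡ λ y → begin
    lookup (relabel σ (X ∩ Y)) y                     ≡⟨ lookup∘tabulate _ y ⟩
    lookup (X ∩ Y) (σ ⟨$⟩ˡ y)                        ≡⟨ lookup-zipWith _∧_ (σ ⟨$⟩ˡ y) X Y ⟩
    lookup X (σ ⟨$⟩ˡ y) ∧ lookup Y (σ ⟨$⟩ˡ y)        ≡⟨ cong₂ _∧_ (lookup∘tabulate _ y) (lookup∘tabulate _ y) ⟨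
    lookup (relabel σ X) y ∧ lookup (relabel σ Y) y  ≡⟨ lookup-zipWith _∧_ y (relabel σ X) (relabel σ Y) ⟨
    lookup (relabel σ X ∩ relabel σ Y) y             ∎

  relabel-injective : ∀ {X Y} → relabel σ X ≡ relabel σ Y → X ≡ Y
  relabel-injective {X} {Y} e = ≗⇒≡ λ x →
    trans (sym (lookup-relabel X x)) (trans (cong (λ Z → lookup Z (σ ⟨$⟩ʳ x)) e) (lookup-relabel Y x))

  relabel-card : ∀ X → ∣ X ∣ ≡ ∣ relabel σ X ∣
  relabel-card X = begin
    ∣ X ∣                             ≡⟨ ∣∣≡count X ⟩
    count (T? ∘ lookup X)             ≡⟨ count-≗ (T? ∘ lookup X′ ∘ (σ ⟨$⟩ʳ_)) (T? ∘ lookup X) (lookup-relabel X) ⟨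
    count (T? ∘ lookup X′ ∘ (σ ⟨$⟩ʳ_)) ≡⟨ count-permute (T? ∘ lookup X′) σ ⟨
    count (T? ∘ lookup X′)            ≡⟨ ∣∣≡count X′ ⟨
    ∣ X′ ∣                            ∎
    where
    X′ : Subset n
    X′ = relabel σ X

  relabel-faithful : ∀ {F₁ : Family m} {F₂ : Family n} →
                     (∀ X → F₁ X → F₂ (relabel σ X)) →
                     (∀ Z → F₂ Z → ∃ λ X → F₁ X × relabel σ X ≡ Z) →
                     FaithfulCorrespondence F₁ F₂
  relabel-faithful {F₁} {F₂} images preimages = record
    { η          = relabel σ
    ; maps-into  = maps-into
    ; injective  = λ _ _ _ _ → relabel-injective
    ; surjective = surjective
    ; card       = λ X _ → relabel-card X
    ; inter-hom  = λ X Y _ _ → relabel-∩ X Y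
    }
    where
    maps-into : ∀ X → (F₁ ^∩) X → (F₂ ^∩) (relabel σ X)
    maps-into X (base X∈)             = base (images X X∈)
    maps-into _ (inter {X} {Y} X∈ Y∈) =
      subst (F₂ ^∩) (sym (relabel-∩ X Y)) (inter (maps-into X X∈) (maps-into Y Y∈))

    surjective : ∀ Z → (F₂ ^∩) Z → ∃ λ X → (F₁ ^∩) X × relabel σ X ≡ Z
    surjective Z (base Z∈) with preimages Z Z∈
    ... | X , X∈ , e = X , base X∈ , e
    surjective _ (inter Z∈ W∈) with surjective _ Z∈ | surjective _ W∈
    ... | X , X∈ , refl | Y , Y∈ , refl = X ∩ Y , inter X∈ Y∈ , relabel-∩ X Y

image : ∀ {n} → (Fin n → Fin n) → Subset n
image f = tabulate (λ y → ⌊ any? (λ x → f x ≟ᶠ y) ⌋)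

∈image : ∀ {n} (f : Fin n → Fin n) y → y ∈ image f ⇔ ∃ λ x → f x ≡ y
∈image f = ∈-decided (λ y → any? (λ x → f x ≟ᶠ y))

module _ {n ℓ} {_≼_ : Rel (Fin n) ℓ} (isDPO : IsDecPartialOrder _≡_ _≼_) where
  open IsDecPartialOrder isDPO using (_≤?_) renaming (trans to ≼-trans)

  ∈Up : ∀ {x y} → y ∈ Up isDPO x ⇔ x ≼ y
  ∈Up {x} {y} = ∈-decided (x ≤?_) y

  pair-bound : ∀ {x y w} → x ≼ w → y ≼ w → ∀ z → z ∈ ⁅ x ⁆ ∪ ⁅ y ⁆ → z ≼ w
  pair-bound {x} {y} {w} x≼w y≼w z z∈ with x∈p∪q⁻ ⁅ x ⁆ ⁅ y ⁆ z∈
  ... | inj₁ z∈x = subst (_≼ w) (sym (x∈⁅y⁆⇒x≡y x z∈x)) x≼w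
  ... | inj₂ z∈y = subst (_≼ w) (sym (x∈⁅y⁆⇒x≡y y z∈y)) y≼w

  -- In an upper semi-lattice Up x ∩ Up y = Up (x ∨ y).
  Up-∩ : IsUpperSemiLattice isDPO → ∀ x y → ∃ λ u → Up isDPO x ∩ Up isDPO y ≡ Up isDPO u
  Up-∩ lub x y with lub (⁅ x ⁆ ∪ ⁅ y ⁆)
  ... | u , upper , least = u , ⊆-antisym ∩⊆Up Up⊆∩
    where
    x≼u : x ≼ u
    x≼u = upper x (x∈p∪q⁺ (inj₁ (x∈⁅x⁆ x)))
    y≼u : y ≼ u
    y≼u = upper y (x∈p∪q⁺ (inj₂ (x∈⁅x⁆ y)))
    ∩⊆Up : Up isDPO x ∩ Up isDPO y ⊆ Up isDPO u
    ∩⊆Up {w} w∈ with x∈p∩q⁻ (Up isDPO x) (Up isDPO y) w∈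
    ... | w∈x , w∈y =
      Equivalence.from ∈Up (least w (pair-bound (Equivalence.to ∈Up w∈x) (Equivalence.to ∈Up w∈y)))
    Up⊆∩ : Up isDPO u ⊆ Up isDPO x ∩ Up isDPO y
    Up⊆∩ w∈ = x∈p∩q⁺ ( Equivalence.from ∈Up (≼-trans x≼u (Equivalence.to ∈Up w∈))
                     , Equivalence.from ∈Up (≼-trans y≼u (Equivalence.to ∈Up w∈)))

  Up^∩ : IsUpperSemiLattice isDPO → ∀ R X → (Up[_] isDPO R ^∩) X → ∃ λ z → Up isDPO z ≡ X
  Up^∩ lub R X (base (x , _ , Upx≡X)) = x , Upx≡X
  Up^∩ lub R _ (inter X∈ Y∈) with Up^∩ lub R _ X∈ | Up^∩ lub R _ Y∈
  ... | x , refl | y , refl = proj₁ (Up-∩ lub x y) , sym (proj₂ (Up-∩ lub x y))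

  iso⇒correspondence : ∀ {m} (G : Graph m) (f : Fin n → Fin n) → GraphIso G (G[_] isDPO f) →
                       m ≡ n × ∃ λ R → FaithfulCorrespondence (𝒪 G) (Up[_] isDPO R)
  iso⇒correspondence {m} G f iso = Perm.↔⇒≡ σ , image f , relabel-faithful σ images preimages
    where
    open GraphIso iso
    σ : Permutation m n
    σ = Perm.permutation to from to∘from from∘to

    relabel-out : ∀ v → relabel σ (out G v) ≡ Up isDPO (f (to v))
    relabel-out v = tabulate-cong λ y → begin
      lookup (out G v) (from y)    ≡⟨ lookup∘tabulate (G v) (from y) ⟩
      G v (from y)                 ≡⟨ edges v (from y) ⟩
      ⌊ f (to v) ≤? to (from y) ⌋  ≡⟨ cong (λ z → ⌊ f (to v) ≤? z ⌋) (to∘from y) ⟩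
      ⌊ f (to v) ≤? y ⌋            ∎

    images : ∀ X → 𝒪 G X → Up[_] isDPO (image f) (relabel σ X)
    images _ (v , refl) = f (to v) , Equivalence.from (∈image f _) (to v , refl) , sym (relabel-out v)

    preimages : ∀ Z → Up[_] isDPO (image f) Z → ∃ λ X → 𝒪 G X × relabel σ X ≡ Z
    preimages _ (z , z∈ , refl) with Equivalence.to (∈image f z) z∈
    ... | x , refl = out G (from x) , (from x , refl) ,
                     trans (relabel-out (from x)) (cong (Up isDPO ∘ f) (to∘from x))

  -- The matrices out_G and η ∘ out_G have equal
  -- superset counts of columns, so their columns match under a permutation π, which is an
  -- isomorphism G ≅ G_f for f = g ∘ π⁻¹.
  correspondence⇒iso : IsUpperSemiLattice isDPO → (G : Graph n) (R : Subset n) →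
                       FaithfulCorrespondence (𝒪 G) (Up[_] isDPO R) →
                       ∃ λ f → GraphIso G (G[_] isDPO f)
  correspondence⇒iso lub G R φ = f , record
    { to = π ⟨$⟩ʳ_ ; from = π ⟨$⟩ˡ_
    ; from∘to = λ _ → Perm.inverseˡ π ; to∘from = λ _ → Perm.inverseʳ π
    ; edges = edges
    }
    where
    open FaithfulCorrespondence φ

    out∈ : ∀ v → (𝒪 G ^∩) (out G v)
    out∈ v = base (v , refl)

    η-out-is-Up : ∀ v → ∃ λ z → Up isDPO z ≡ η (out G v)
    η-out-is-Up v = Up^∩ lub R _ (maps-into _ (out∈ v))

    g : Fin n → Fin n
    g v = proj₁ (η-out-is-Up v)

    same : SameSupersets (column (out G)) (column (η ∘ out G))
    same S = begin
      supersets (column (out G)) S        ≡⟨ supersets-column (out G) S ⟩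
      ∣ ⋂[ S ] out G ∣                    ≡⟨ ∣η-⋂∣ φ refl (out G) out∈ S ⟩
      ∣ ⋂[ S ] (η ∘ out G) ∣              ≡⟨ supersets-column (η ∘ out G) S ⟨
      supersets (column (η ∘ out G)) S    ∎

    columns-match : Σ (Permutation n n) λ π → ∀ w → column (η ∘ out G) (π ⟨$⟩ʳ w) ≡ column (out G) w
    columns-match = matching n n (column (out G)) (column (η ∘ out G)) same

    π : Permutation n n
    π = proj₁ columns-match

    f : Fin n → Fin n
    f y = g (π ⟨$⟩ˡ y)

    edges : ∀ u w → G u w ≡ ⌊ f (π ⟨$⟩ʳ u) ≤? π ⟨$⟩ʳ w ⌋
    edges u w = begin
      G u w                              ≡⟨ lookup∘tabulate (G u) w ⟨
      lookup (out G u) w                 ≡⟨ columns-reindexed (out G) (η ∘ out G) _ (proj₂ columns-match) u w ⟩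
      lookup (η (out G u)) (π ⟨$⟩ʳ w)    ≡⟨ cong (λ X → lookup X (π ⟨$⟩ʳ w)) (proj₂ (η-out-is-Up u)) ⟨
      lookup (Up isDPO (g u)) (π ⟨$⟩ʳ w) ≡⟨ lookup∘tabulate _ (π ⟨$⟩ʳ w) ⟩
      ⌊ g u ≤? π ⟨$⟩ʳ w ⌋                ≡⟨ cong (λ v → ⌊ g v ≤? π ⟨$⟩ʳ w ⌋) (Perm.inverseˡ π) ⟨
      ⌊ f (π ⟨$⟩ʳ u) ≤? π ⟨$⟩ʳ w ⌋       ∎

lemma4p2 : ∀ {ℓ : Level} (n : ℕ) (_≤_ : Rel (Fin n) ℓ)
             (isDPO : IsDecPartialOrder _≡_ _≤_) →
             IsUpperSemiLattice isDPO →
             ∀ (m : ℕ) (G : Graph m) →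
             (∃ λ (f : Fin n → Fin n) → GraphIso G (G[_] isDPO f))
             ⇔ (m ≡ n × ∃ λ (R : Subset n) → FaithfulCorrespondence (𝒪 G) (Up[_] isDPO R))
lemma4p2 n _≤_ isDPO lub m G = mk⇔
  (λ { (f , iso) → iso⇒correspondence isDPO G f iso })
  (λ { (refl , R , φ) → correspondence⇒iso isDPO lub G R φ })
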